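{- Let $H$ be a multigraph without self-loops such that $|E(H)|\ge 25\,\Delta(H)$, where $\Delta(H)$ is the maximum degree of $H$. Then there is a partition $(V_r,V_b,V_g)$ of $V(H)$ such that $|E(H[V_c])|\ge |E(H)|/180$ for every $c\in\{r,b,g\}$.
   Context: Degrees in a multigraph count parallel edges with multiplicity; $H[W]$ denotes the sub-multigraph induced by $W$, and $E(H[W])$ its edge multiset. -}

module Defs where

open import Data.Nat using (ℕ; _⊔_)
open import Data.Fin using (Fin; _≟_)
open import Data.Product using (_×_; _,_; proj₁; proj₂)
open import Data.List using (List; length; filter; foldr; map; allFin)
open import Data.List.Relation.Unary.All using (All)
open import Relation.Nullary using (¬_; Dec; yes; no)
open import Relation.Nullary.Decidable using (_⊎-dec_; _×-dec_)
open import Relation.Binary.PropositionalEquality using (_≡_)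

-- A finite multigraph on vertex set Fin n: a list of edges (unordered pairs
-- recorded as ordered pairs of endpoints); parallel edges = repeated entries.
record Multigraph (n : ℕ) : Set where
  field
    edges : List (Fin n × Fin n)

open Multigraph public

Loopless : ∀ {n} → Multigraph n → Set
Loopless H = All (λ e → ¬ (proj₁ e ≡ proj₂ e)) (edges H)

numEdges : ∀ {n} → Multigraph n → ℕ
numEdges H = length (edges H)

degree : ∀ {n} → Multigraph n → Fin n → ℕ
degree H v = length (filter (λ e → (proj₁ e ≟ v) ⊎-dec (proj₂ e ≟ v)) (edges H))

maxDegree : ∀ {n} → Multigraph n → ℕ
maxDegree {n} H = foldr _⊔_ 0 (map (degree H) (allFin n))

-- |E(H[V_c])| where V_c = { v | col v = c }: edges with both ends coloured c.
inducedEdges : ∀ {n} → Multigraph n → (Fin n → Fin 3) → Fin 3 → ℕ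
inducedEdges H col c =
  length (filter (λ e → (col (proj₁ e) ≟ c) ×-dec (col (proj₂ e) ≟ c)) (edges H))

-- Write m = |E(H)|, vol P for the sum of the degrees in P and cut P for the number of edges leaving P,
-- so that vol P + vol (V∖P) = 2m and vol P = 2·e(P) + cut P.  Grow P from ∅ one vertex at a time,
-- keeping the invariant 2m·cut P ≤ vol P·vol (V∖P) + Δ·vol P: by averaging, some vertex outside P sends
-- at least the fraction cut P / vol (V∖P) of its edges into P, and adding it preserves the invariant.
-- Stopping as soon as vol P ≥ m gives m ≤ vol P ≤ m + Δ, and then the invariant forces
-- m ≤ 4·e(P) + 4Δ and m ≤ 4·e(V∖P) + 4Δ.  Splitting H in this way, and then H[V∖P] again, yields three
-- classes each spanning at least (m − 20Δ)/16 ≥ m/80 edges when 25Δ ≤ m.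

module Submission where

open import Defs
open import Data.Bool using (Bool; true; false; not; _∧_; _∨_; T?)
open import Data.Bool.Properties using (∧-commutativeMonoid; ∧-identityʳ; ∧-zeroʳ)
open import Data.Empty using (⊥-elim)
open import Data.Fin using (Fin; zero; suc; _≟_)
open import Data.List using (List; []; _∷_; length; map; filter; filterᵇ; foldr)
open import Data.List.Membership.Propositional using (_∈_)
open import Data.List.Membership.Propositional.Properties using (∈-allFin; ∈-map⁺)
open import Data.List.Properties using (map-cong; map-cong-local)
import Data.List.Relation.Unary.All as All
open import Data.List.Relation.Unary.All.Properties using (filter⁺)
open import Data.List.Relation.Unary.Any using (here; there)
open import Data.Nat using (ℕ; zero; suc; _+_; _*_; _≤_; _<_; _≤?_; _<?_; _⊔_; z≤n; s≤s; NonZero; >-nonZero)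
open import Data.Nat.ListAction using () renaming (sum to sumˡ)
open import Data.Nat.Properties hiding (_≟_)
open import Data.Nat.Solver using (module +-*-Solver)
import Data.Product as Product
open import Data.Product using (Σ; ∃-syntax; _×_; _,_; proj₁; proj₂)
open import Function using (_∘_; id)
open import Relation.Binary.PropositionalEquality
  using (_≡_; refl; sym; trans; cong; cong₂; subst; subst₂; module ≡-Reasoning)
open import Relation.Nullary using (Dec; does; yes; no; ¬_)

open import Algebra.Properties.Semiring.Sum +-*-semiring
  using (sum; sum-syntax; sum-cong-≗; sum-replicate-zero; ∑-distrib-+)
open import Algebra.Bundles using (CommutativeMonoid)
import Algebra.Properties.CommutativeSemigroup as CommutativeSemigroupProperties
open +-*-Solver using (solve; _:=_; _:+_; _:*_; con)

+-interchange : ∀ a b c d → (a + b) + (c + d) ≡ (a + c) + (b + d)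
+-interchange = CommutativeSemigroupProperties.interchange +-commutativeSemigroup

∧-interchange : ∀ a b c d → (a ∧ b) ∧ (c ∧ d) ≡ (a ∧ c) ∧ (b ∧ d)
∧-interchange = CommutativeSemigroupProperties.interchange
  (CommutativeMonoid.commutativeSemigroup ∧-commutativeMonoid)

⟦_⟧ : Bool → ℕ
⟦ true ⟧ = 1
⟦ false ⟧ = 0

⟦∧⟧ : ∀ a b → ⟦ a ∧ b ⟧ ≡ ⟦ a ⟧ * ⟦ b ⟧
⟦∧⟧ true b = sym (+-identityʳ ⟦ b ⟧)
⟦∧⟧ false b = refl

∑ˡ : {A : Set} → List A → (A → ℕ) → ℕ
∑ˡ xs f = sumˡ (map f xs)

infixl 10 ∑ˡ
syntax ∑ˡ xs (λ x → e) = ∑[ x ∈ xs ] e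

module _ {A : Set} where

  ∑ˡ-cong : ∀ (xs : List A) {f g : A → ℕ} → (∀ x → f x ≡ g x) → ∑ˡ xs f ≡ ∑ˡ xs g
  ∑ˡ-cong xs f≗g = cong sumˡ (map-cong f≗g xs)

  ∑ˡ-mono-≤ : ∀ (xs : List A) {f g : A → ℕ} → (∀ x → f x ≤ g x) → ∑ˡ xs f ≤ ∑ˡ xs g
  ∑ˡ-mono-≤ [] f≤g = z≤n
  ∑ˡ-mono-≤ (x ∷ xs) f≤g = +-mono-≤ (f≤g x) (∑ˡ-mono-≤ xs f≤g)

  ∑ˡ-distrib-+ : ∀ (xs : List A) (f g : A → ℕ) →
                 ∑[ x ∈ xs ] (f x + g x) ≡ ∑ˡ xs f + ∑ˡ xs g
  ∑ˡ-distrib-+ [] f g = refl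
  ∑ˡ-distrib-+ (x ∷ xs) f g = trans (cong (f x + g x +_) (∑ˡ-distrib-+ xs f g))
    (+-interchange (f x) (g x) (∑ˡ xs f) (∑ˡ xs g))

  ∑ˡ-zero : ∀ (xs : List A) → ∑[ x ∈ xs ] 0 ≡ 0
  ∑ˡ-zero [] = refl
  ∑ˡ-zero (x ∷ xs) = ∑ˡ-zero xs

  ∑ˡ-one : ∀ (xs : List A) → ∑[ x ∈ xs ] 1 ≡ length xs
  ∑ˡ-one [] = refl
  ∑ˡ-one (x ∷ xs) = cong suc (∑ˡ-one xs)

  length-filter≡∑ˡ : ∀ {p} {P : A → Set p} (P? : ∀ x → Dec (P x)) (xs : List A) →
                     length (filter P? xs) ≡ ∑[ x ∈ xs ] ⟦ does (P? x) ⟧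
  length-filter≡∑ˡ P? [] = refl
  length-filter≡∑ˡ P? (x ∷ xs) with does (P? x)
  ... | true = cong suc (length-filter≡∑ˡ P? xs)
  ... | false = length-filter≡∑ˡ P? xs

  ∑ˡ-filterᵇ : ∀ (p : A → Bool) (xs : List A) (f : A → ℕ) →
               ∑ˡ (filterᵇ p xs) f ≡ ∑[ x ∈ xs ] (⟦ p x ⟧ * f x)
  ∑ˡ-filterᵇ p [] f = refl
  ∑ˡ-filterᵇ p (x ∷ xs) f with p x
  ... | true = cong₂ _+_ (sym (+-identityʳ (f x))) (∑ˡ-filterᵇ p xs f)
  ... | false = ∑ˡ-filterᵇ p xs f

  ∑ˡ-filterᵇ-≤ : ∀ (p : A → Bool) (xs : List A) (f : A → ℕ) → ∑ˡ (filterᵇ p xs) f ≤ ∑ˡ xs f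
  ∑ˡ-filterᵇ-≤ p [] f = z≤n
  ∑ˡ-filterᵇ-≤ p (x ∷ xs) f with p x
  ... | true = +-monoʳ-≤ (f x) (∑ˡ-filterᵇ-≤ p xs f)
  ... | false = ≤-trans (∑ˡ-filterᵇ-≤ p xs f) (m≤n+m _ (f x))

∑-mono-≤ : ∀ {n} {f g : Fin n → ℕ} → (∀ v → f v ≤ g v) → sum f ≤ sum g
∑-mono-≤ {zero} _ = z≤n
∑-mono-≤ {suc n} f≤g = +-mono-≤ (f≤g zero) (∑-mono-≤ (f≤g ∘ suc))

∑-δ : ∀ {n} (u : Fin n) (g : Fin n → ℕ) → ∑[ v < n ] (⟦ does (u ≟ v) ⟧ * g v) ≡ g u
∑-δ {suc n} zero g = trans (cong (g zero + 0 +_) (sum-replicate-zero n)) (trans (+-identityʳ _) (+-identityʳ _))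
∑-δ {suc n} (suc u) g = ∑-δ u (g ∘ suc)

∑-∑ˡ-comm : ∀ {n} {A : Set} (g : Fin n → ℕ) (xs : List A) (F : Fin n → A → ℕ) →
            ∑[ v < n ] (g v * ∑ˡ xs (F v)) ≡ ∑[ x ∈ xs ] ∑[ v < n ] (g v * F v x)
∑-∑ˡ-comm {n} g [] F = trans (sum-cong-≗ (λ v → *-zeroʳ (g v))) (sum-replicate-zero n)
∑-∑ˡ-comm {n} g (x ∷ xs) F = begin
  ∑[ v < n ] (g v * (F v x + ∑ˡ xs (F v)))
    ≡⟨ sum-cong-≗ (λ v → *-distribˡ-+ (g v) (F v x) _) ⟩
  ∑[ v < n ] (g v * F v x + g v * ∑ˡ xs (F v))
    ≡⟨ ∑-distrib-+ (λ v → g v * F v x) _ ⟩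
  ∑[ v < n ] (g v * F v x) + ∑[ v < n ] (g v * ∑ˡ xs (F v))
    ≡⟨ cong (∑[ v < n ] (g v * F v x) +_) (∑-∑ˡ-comm g xs F) ⟩
  ∑[ v < n ] (g v * F v x) + ∑[ y ∈ xs ] ∑[ v < n ] (g v * F v y) ∎
  where open ≡-Reasoning

averaging : ∀ {n} (A D : Fin n → ℕ) {c y : ℕ} → (∀ v → A v ≤ D v) → 0 < sum D →
            sum D * c ≤ sum A * y → ∃[ v ] 0 < D v × D v * c ≤ A v * y
averaging {suc n} A D {c} {y} A≤D 0<ΣD ΣDc≤ΣAy with 0 <? D zero | D zero * c ≤? A zero * y
... | yes 0<D₀ | yes D₀c≤A₀y = zero , 0<D₀ , D₀c≤A₀y
... | no 0≮D₀ | _ = Product.map suc id (averaging (A ∘ suc) (D ∘ suc) (A≤D ∘ suc) 0<ΣD′ ΣD′c≤ΣA′y)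
  where
  D₀≡0 : D zero ≡ 0
  D₀≡0 = n≤0⇒n≡0 (≮⇒≥ 0≮D₀)
  A₀≡0 : A zero ≡ 0
  A₀≡0 = n≤0⇒n≡0 (≤-trans (A≤D zero) (≮⇒≥ 0≮D₀))
  0<ΣD′ : 0 < sum (D ∘ suc)
  0<ΣD′ = subst (0 <_) (cong (_+ sum (D ∘ suc)) D₀≡0) 0<ΣD
  ΣD′c≤ΣA′y : sum (D ∘ suc) * c ≤ sum (A ∘ suc) * y
  ΣD′c≤ΣA′y = subst₂ (λ d a → (d + sum (D ∘ suc)) * c ≤ (a + sum (A ∘ suc)) * y) D₀≡0 A₀≡0 ΣDc≤ΣAy
... | yes _ | no D₀c≰A₀y =
  Product.map suc id (averaging (A ∘ suc) (D ∘ suc) (A≤D ∘ suc) 0<ΣD′ (<⇒≤ ΣD′c<ΣA′y))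
  where
  ΣD′c<ΣA′y : sum (D ∘ suc) * c < sum (A ∘ suc) * y
  ΣD′c<ΣA′y = +-cancelˡ-< (A zero * y) _ _ (begin-strict
    A zero * y + sum (D ∘ suc) * c <⟨ +-monoˡ-< _ (≰⇒> D₀c≰A₀y) ⟩
    D zero * c + sum (D ∘ suc) * c ≡⟨ *-distribʳ-+ c (D zero) _ ⟨
    sum D * c                      ≤⟨ ΣDc≤ΣAy ⟩
    sum A * y                      ≡⟨ *-distribʳ-+ y (A zero) _ ⟩
    A zero * y + sum (A ∘ suc) * y ∎)
    where open ≤-Reasoning
  positive-factor : ∀ a {b} → 0 < a * b → 0 < a
  positive-factor (suc a) _ = s≤s z≤n
  0<ΣD′ : 0 < sum (D ∘ suc)
  0<ΣD′ = <-≤-trans (positive-factor (sum (A ∘ suc)) (≤-<-trans z≤n ΣD′c<ΣA′y))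
                    (∑-mono-≤ (A≤D ∘ suc))

VertexSet : ℕ → Set
VertexSet n = Fin n → Bool

module _ {n : ℕ} where

  ∅ : VertexSet n
  ∅ _ = false

  ∁ : VertexSet n → VertexSet n
  ∁ P v = not (P v)

  _∪_ _∩_ : VertexSet n → VertexSet n → VertexSet n
  (P ∪ Q) v = P v ∨ Q v
  (P ∩ Q) v = P v ∧ Q v

  ｛_｝ : Fin n → VertexSet n
  ｛ v ｝ u = does (u ≟ v)

  Disjoint : VertexSet n → VertexSet n → Set
  Disjoint P Q = ∀ v → P v ∧ Q v ≡ false

  inside : VertexSet n → Fin n × Fin n → Bool
  inside P (u , w) = P u ∧ P w

  _[_] : Multigraph n → VertexSet n → Multigraph n
  H [ Q ] = record { edges = filterᵇ (inside Q) (edges H) }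

  vol : VertexSet n → Multigraph n → ℕ
  vol P H = ∑[ e ∈ edges H ] (⟦ P (proj₁ e) ⟧ + ⟦ P (proj₂ e) ⟧)

  inner : VertexSet n → Multigraph n → ℕ
  inner P H = ∑[ e ∈ edges H ] ⟦ inside P e ⟧

  between : VertexSet n → VertexSet n → Multigraph n → ℕ
  between P Q H = ∑[ e ∈ edges H ] (⟦ P (proj₁ e) ∧ Q (proj₂ e) ⟧ + ⟦ P (proj₂ e) ∧ Q (proj₁ e) ⟧)

  cut : VertexSet n → Multigraph n → ℕ
  cut P = between P (∁ P)

  deg : Multigraph n → Fin n → ℕ
  deg H v = vol ｛ v ｝ H

  vol≡2inner+cut : ∀ (P : VertexSet n) H → vol P H ≡ inner P H + inner P H + cut P H
  vol≡2inner+cut P H = sym (begin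
    inner P H + inner P H + cut P H
      ≡⟨ cong (_+ cut P H) (∑ˡ-distrib-+ (edges H) (⟦_⟧ ∘ inside P) (⟦_⟧ ∘ inside P)) ⟨
    ∑[ e ∈ edges H ] (⟦ inside P e ⟧ + ⟦ inside P e ⟧) + cut P H
      ≡⟨ ∑ˡ-distrib-+ (edges H) _ _ ⟨
    _ ≡⟨ ∑ˡ-cong (edges H) (λ e → split (P (proj₁ e)) (P (proj₂ e))) ⟩
    vol P H ∎)
    where
    open ≡-Reasoning
    split : ∀ a b → ⟦ a ∧ b ⟧ + ⟦ a ∧ b ⟧ + (⟦ a ∧ not b ⟧ + ⟦ b ∧ not a ⟧) ≡ ⟦ a ⟧ + ⟦ b ⟧
    split true true = refl
    split true false = refl
    split false true = refl
    split false false = refl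

  cut-∁ : ∀ (P : VertexSet n) H → cut (∁ P) H ≡ cut P H
  cut-∁ P H = ∑ˡ-cong (edges H) (λ e → swap (P (proj₁ e)) (P (proj₂ e)))
    where
    swap : ∀ a b → ⟦ not a ∧ not (not b) ⟧ + ⟦ not b ∧ not (not a) ⟧ ≡ ⟦ a ∧ not b ⟧ + ⟦ b ∧ not a ⟧
    swap true true = refl
    swap true false = refl
    swap false true = refl
    swap false false = refl

  inner-cong : ∀ (H : Multigraph n) {P Q : VertexSet n} → (∀ v → P v ≡ Q v) → inner P H ≡ inner Q H
  inner-cong H P≗Q = ∑ˡ-cong (edges H) λ e → cong₂ (λ a b → ⟦ a ∧ b ⟧) (P≗Q (proj₁ e)) (P≗Q (proj₂ e))

  vol+vol-∁ : ∀ (P : VertexSet n) H → vol P H + vol (∁ P) H ≡ numEdges H + numEdges H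
  vol+vol-∁ P H = begin
    vol P H + vol (∁ P) H ≡⟨ ∑ˡ-distrib-+ (edges H) _ _ ⟨
    _                     ≡⟨ ∑ˡ-cong (edges H) (λ e → two (P (proj₁ e)) (P (proj₂ e))) ⟩
    ∑[ e ∈ edges H ] (1 + 1) ≡⟨ ∑ˡ-distrib-+ (edges H) _ _ ⟩
    ∑[ e ∈ edges H ] 1 + ∑[ e ∈ edges H ] 1 ≡⟨ cong₂ _+_ (∑ˡ-one (edges H)) (∑ˡ-one (edges H)) ⟩
    numEdges H + numEdges H ∎
    where
    open ≡-Reasoning
    two : ∀ a b → ⟦ a ⟧ + ⟦ b ⟧ + (⟦ not a ⟧ + ⟦ not b ⟧) ≡ 1 + 1
    two true true = refl
    two true false = refl
    two false true = refl
    two false false = refl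

  between≤vol : ∀ (P Q : VertexSet n) H → between P Q H ≤ vol Q H
  between≤vol P Q H = ∑ˡ-mono-≤ (edges H) λ e →
    ≤-trans (+-mono-≤ (⟦∧⟧≤ʳ (P (proj₁ e)) _) (⟦∧⟧≤ʳ (P (proj₂ e)) _))
            (≤-reflexive (+-comm ⟦ Q (proj₂ e) ⟧ _))
    where
    ⟦∧⟧≤ʳ : ∀ a b → ⟦ a ∧ b ⟧ ≤ ⟦ b ⟧
    ⟦∧⟧≤ʳ true b = ≤-refl
    ⟦∧⟧≤ʳ false b = z≤n

  vol-∪ : ∀ (P Q : VertexSet n) H → Disjoint P Q → vol (P ∪ Q) H ≡ vol P H + vol Q H
  vol-∪ P Q H P∩Q≡∅ = trans
    (∑ˡ-cong (edges H) λ e → trans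
      (cong₂ _+_ (⟦∨⟧ (P (proj₁ e)) _ (P∩Q≡∅ (proj₁ e))) (⟦∨⟧ (P (proj₂ e)) _ (P∩Q≡∅ (proj₂ e))))
      (+-interchange ⟦ P (proj₁ e) ⟧ _ _ _))
    (∑ˡ-distrib-+ (edges H) _ _)
    where
    ⟦∨⟧ : ∀ a b → a ∧ b ≡ false → ⟦ a ∨ b ⟧ ≡ ⟦ a ⟧ + ⟦ b ⟧
    ⟦∨⟧ true true ()
    ⟦∨⟧ true false _ = refl
    ⟦∨⟧ false b _ = refl

  cut-∪ : ∀ (P Q : VertexSet n) H → Disjoint P Q →
          cut (P ∪ Q) H + (between P Q H + between P Q H) ≡ cut P H + cut Q H
  cut-∪ P Q H P∩Q≡∅ = begin
    cut (P ∪ Q) H + (between P Q H + between P Q H)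
      ≡⟨ cong (cut (P ∪ Q) H +_) (∑ˡ-distrib-+ (edges H) _ _) ⟨
    _ ≡⟨ ∑ˡ-distrib-+ (edges H) _ _ ⟨
    _ ≡⟨ ∑ˡ-cong (edges H) (λ e → edge (P (proj₁ e)) (Q (proj₁ e)) (P (proj₂ e)) (Q (proj₂ e))
                                       (P∩Q≡∅ (proj₁ e)) (P∩Q≡∅ (proj₂ e))) ⟩
    _ ≡⟨ ∑ˡ-distrib-+ (edges H) _ _ ⟩
    cut P H + cut Q H ∎
    where
    open ≡-Reasoning
    edge : ∀ a b c d → a ∧ b ≡ false → c ∧ d ≡ false →
           ⟦ (a ∨ b) ∧ not (c ∨ d) ⟧ + ⟦ (c ∨ d) ∧ not (a ∨ b) ⟧
             + ((⟦ a ∧ d ⟧ + ⟦ c ∧ b ⟧) + (⟦ a ∧ d ⟧ + ⟦ c ∧ b ⟧))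
           ≡ ⟦ a ∧ not c ⟧ + ⟦ c ∧ not a ⟧ + (⟦ b ∧ not d ⟧ + ⟦ d ∧ not b ⟧)
    edge true true _ _ () _
    edge _ _ true true _ ()
    edge true false true false _ _ = refl
    edge true false false true _ _ = refl
    edge true false false false _ _ = refl
    edge false true true false _ _ = refl
    edge false true false true _ _ = refl
    edge false true false false _ _ = refl
    edge false false true false _ _ = refl
    edge false false false true _ _ = refl
    edge false false false false _ _ = refl

  disjoint-｛｝ : ∀ {P : VertexSet n} {v} → P v ≡ false → Disjoint P ｛ v ｝
  disjoint-｛｝ {P} {v} Pv≡false u with u ≟ v
  ... | yes refl = trans (∧-identityʳ (P u)) Pv≡false
  ... | no _ = ∧-zeroʳ (P u)

  cut-｛｝ : ∀ {H : Multigraph n} → Loopless H → ∀ v → cut ｛ v ｝ H ≡ deg H v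
  cut-｛｝ {H} loopless v = cong sumˡ (map-cong-local (All.map (λ {e} → edge (proj₁ e) (proj₂ e)) loopless))
    where
    edge : ∀ u w → ¬ u ≡ w →
           ⟦ ｛ v ｝ u ∧ not (｛ v ｝ w) ⟧ + ⟦ ｛ v ｝ w ∧ not (｛ v ｝ u) ⟧ ≡ ⟦ ｛ v ｝ u ⟧ + ⟦ ｛ v ｝ w ⟧
    edge u w u≢w with u ≟ v | w ≟ v
    ... | yes refl | yes refl = ⊥-elim (u≢w refl)
    ... | yes _ | no _ = refl
    ... | no _ | yes _ = refl
    ... | no _ | no _ = refl

  cut-｛｝≤degree : ∀ (H : Multigraph n) v → cut ｛ v ｝ H ≤ degree H v
  cut-｛｝≤degree H v = subst (cut ｛ v ｝ H ≤_) (sym (length-filter≡∑ˡ _ (edges H)))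
    (∑ˡ-mono-≤ (edges H) (λ e → edge (｛ v ｝ (proj₁ e)) (｛ v ｝ (proj₂ e))))
    where
    edge : ∀ a b → ⟦ a ∧ not b ⟧ + ⟦ b ∧ not a ⟧ ≤ ⟦ a ∨ b ⟧
    edge true true = z≤n
    edge true false = ≤-refl
    edge false true = ≤-refl
    edge false false = ≤-refl

  ∑-select : ∀ (Q : VertexSet n) b u → ∑[ v < n ] (⟦ Q v ⟧ * ⟦ b ∧ ｛ v ｝ u ⟧) ≡ ⟦ b ∧ Q u ⟧
  ∑-select Q false u = trans (sum-cong-≗ (λ v → *-zeroʳ ⟦ Q v ⟧)) (sum-replicate-zero n)
  ∑-select Q true u = trans (sum-cong-≗ (λ v → *-comm ⟦ Q v ⟧ _)) (∑-δ u (⟦_⟧ ∘ Q))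

  ∑-select₂ : ∀ (Q : VertexSet n) a b u w →
              ∑[ v < n ] (⟦ Q v ⟧ * (⟦ a ∧ ｛ v ｝ u ⟧ + ⟦ b ∧ ｛ v ｝ w ⟧)) ≡ ⟦ a ∧ Q u ⟧ + ⟦ b ∧ Q w ⟧
  ∑-select₂ Q a b u w = begin
    ∑[ v < n ] (⟦ Q v ⟧ * (⟦ a ∧ ｛ v ｝ u ⟧ + ⟦ b ∧ ｛ v ｝ w ⟧))
      ≡⟨ sum-cong-≗ (λ v → *-distribˡ-+ ⟦ Q v ⟧ _ _) ⟩
    ∑[ v < n ] (⟦ Q v ⟧ * ⟦ a ∧ ｛ v ｝ u ⟧ + ⟦ Q v ⟧ * ⟦ b ∧ ｛ v ｝ w ⟧)
      ≡⟨ ∑-distrib-+ (λ v → ⟦ Q v ⟧ * ⟦ a ∧ ｛ v ｝ u ⟧) _ ⟩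
    _ ≡⟨ cong₂ _+_ (∑-select Q a u) (∑-select Q b w) ⟩
    ⟦ a ∧ Q u ⟧ + ⟦ b ∧ Q w ⟧ ∎
    where open ≡-Reasoning

  ∑-deg≡vol : ∀ (Q : VertexSet n) H → ∑[ v < n ] (⟦ Q v ⟧ * deg H v) ≡ vol Q H
  ∑-deg≡vol Q H = trans (∑-∑ˡ-comm (⟦_⟧ ∘ Q) (edges H) _)
    (∑ˡ-cong (edges H) λ e → ∑-select₂ Q true true (proj₁ e) (proj₂ e))

  ∑-between-｛｝≡between : ∀ (P Q : VertexSet n) H → ∑[ v < n ] (⟦ Q v ⟧ * between P ｛ v ｝ H) ≡ between P Q H
  ∑-between-｛｝≡between P Q H = trans (∑-∑ˡ-comm (⟦_⟧ ∘ Q) (edges H) _)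
    (∑ˡ-cong (edges H) λ e → ∑-select₂ Q (P (proj₁ e)) (P (proj₂ e)) (proj₂ e) (proj₁ e))

  numEdges-[] : ∀ (H : Multigraph n) Q → numEdges (H [ Q ]) ≡ inner Q H
  numEdges-[] H Q = length-filter≡∑ˡ (T? ∘ inside Q) (edges H)

  inner-[] : ∀ (H : Multigraph n) Q P → inner P (H [ Q ]) ≡ inner (Q ∩ P) H
  inner-[] H Q P = trans (∑ˡ-filterᵇ (inside Q) (edges H) _) (∑ˡ-cong (edges H) λ e →
    trans (sym (⟦∧⟧ (inside Q e) _)) (cong ⟦_⟧ (∧-interchange (Q (proj₁ e)) _ _ _)))

  deg-[]≤deg : ∀ (H : Multigraph n) Q v → deg (H [ Q ]) v ≤ deg H v
  deg-[]≤deg H Q v = ∑ˡ-filterᵇ-≤ (inside Q) (edges H) _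

  loopless-[] : ∀ {H : Multigraph n} → Loopless H → ∀ Q → Loopless (H [ Q ])
  loopless-[] loopless Q = filter⁺ (T? ∘ inside Q) loopless

-- Adding a vertex of degree δ with a edges into P turns the cut c into c′ = c + δ − 2a, and a ≥ δc/y
-- gives y·c′ ≤ (y − 2δ)·c + y·δ; the invariant for c then implies it for c′ because δ ≤ Δ.
small-cut-step : ∀ {T x y y′ δ Δ c c′ a} → T ≡ x + y → y ≡ δ + y′ → 0 < δ → δ + δ ≤ y → δ ≤ Δ →
                 c′ + (a + a) ≡ c + δ → δ * c ≤ a * y → T * c ≤ x * y + Δ * x →
                 T * c′ ≤ (x + δ) * y′ + Δ * (x + δ)
small-cut-step {x = x} {δ = δ} {c = c} {c′} {a} refl refl 0<δ 2δ≤y δ≤Δ c′+2a≡c+δ δc≤ay Tc≤xy+Δx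
  with s , refl ← m≤n⇒∃[o]m+o≡n (+-cancelˡ-≤ δ δ _ 2δ≤y)
     | r , refl ← m≤n⇒∃[o]m+o≡n δ≤Δ
  = *-cancelˡ-≤ y (begin
    y * (T * c′)                         ≤⟨ yTc′≤sTc+yTδ ⟩
    s * (T * c) + y * (T * δ)            ≤⟨ +-monoˡ-≤ _ (*-monoʳ-≤ s Tc≤xy+Δx) ⟩
    s * (x * y + Δ * x) + y * (T * δ)    ≤⟨ m≤m+n _ (y * δ * r + 2 * Δ * x * δ) ⟩
    s * (x * y + Δ * x) + y * (T * δ) + (y * δ * r + 2 * Δ * x * δ)
      ≡⟨ solve 4 (λ x δ s r → let Y = δ :+ (δ :+ s) ; D = δ :+ r in
           s :* (x :* Y :+ D :* x) :+ Y :* ((x :+ Y) :* δ) :+ (Y :* δ :* r :+ con 2 :* D :* x :* δ)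
             := Y :* ((x :+ δ) :* (δ :+ s) :+ D :* (x :+ δ))) refl x δ s r ⟩
    y * ((x + δ) * (δ + s) + Δ * (x + δ)) ∎)
  where
  open ≤-Reasoning
  y = δ + (δ + s)
  T = x + y
  Δ = δ + r
  instance
    y≢0 : NonZero y
    y≢0 = >-nonZero (≤-trans 0<δ (m≤m+n δ _))
  yTc′≤sTc+yTδ : y * (T * c′) ≤ s * (T * c) + y * (T * δ)
  yTc′≤sTc+yTδ = +-cancelʳ-≤ (T * (δ * c) + T * (δ * c)) _ _ (begin
    y * (T * c′) + (T * (δ * c) + T * (δ * c))
      ≤⟨ +-monoʳ-≤ (y * (T * c′)) (+-mono-≤ (*-monoʳ-≤ T δc≤ay) (*-monoʳ-≤ T δc≤ay)) ⟩
    y * (T * c′) + (T * (a * y) + T * (a * y))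
      ≡⟨ solve 4 (λ Y T c′ a → Y :* (T :* c′) :+ (T :* (a :* Y) :+ T :* (a :* Y)) := Y :* T :* (c′ :+ (a :+ a)))
               refl y T c′ a ⟩
    y * T * (c′ + (a + a)) ≡⟨ cong (y * T *_) c′+2a≡c+δ ⟩
    y * T * (c + δ)
      ≡⟨ solve 4 (λ δ s T c → let Y = δ :+ (δ :+ s) in
           Y :* T :* (c :+ δ) := s :* (T :* c) :+ Y :* (T :* δ) :+ (T :* (δ :* c) :+ T :* (δ :* c)))
               refl δ s T c ⟩
    s * (T * c) + y * (T * δ) + (T * (δ * c) + T * (δ * c)) ∎)

square≤ : ∀ {T z w e c K} → z + w ≡ T → z ≡ e + e + c → T * c ≤ z * w + K → z * z ≤ T * (e + e) + K
square≤ {T} {z} {w} {e} {c} {K} refl refl Tc≤zw+K = +-cancelʳ-≤ (z * w) _ _ (begin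
  z * z + z * w           ≡⟨ *-distribˡ-+ z z w ⟨
  z * T                   ≡⟨ *-comm z T ⟩
  T * (e + e + c)         ≡⟨ *-distribˡ-+ T (e + e) c ⟩
  T * (e + e) + T * c     ≤⟨ +-monoʳ-≤ (T * (e + e)) Tc≤zw+K ⟩
  T * (e + e) + (z * w + K) ≡⟨ solve 3 (λ A B C → A :+ (B :+ C) := A :+ C :+ B) refl (T * (e + e)) (z * w) K ⟩
  T * (e + e) + K + z * w ∎)
  where open ≤-Reasoning

large-side : ∀ {m x e Δ} → m ≤ x → x * x ≤ (m + m) * (e + e) + Δ * x → m ≤ 4 * e + 4 * Δ
large-side {zero} _ _ = z≤n
large-side {m@(suc _)} {x} {e} {Δ} m≤x xx≤ = begin
  m             ≤⟨ m≤x ⟩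
  x             ≤⟨ *-cancelˡ-≤ x (begin
    x * x                       ≤⟨ xx≤ ⟩
    (m + m) * (e + e) + Δ * x   ≤⟨ +-monoˡ-≤ (Δ * x) (*-monoˡ-≤ (e + e) (+-mono-≤ m≤x m≤x)) ⟩
    (x + x) * (e + e) + Δ * x   ≡⟨ solve 3 (λ x e Δ → (x :+ x) :* (e :+ e) :+ Δ :* x := x :* (con 4 :* e :+ Δ)) refl x e Δ ⟩
    x * (4 * e + Δ)             ∎) ⟩
  4 * e + Δ     ≤⟨ +-monoʳ-≤ (4 * e) (m≤n*m Δ 4) ⟩
  4 * e + 4 * Δ ∎
  where
  open ≤-Reasoning
  instance
    x≢0 : NonZero x
    x≢0 = >-nonZero (≤-trans (s≤s z≤n) m≤x)

small-side : ∀ {m x y e Δ} → m ≤ x → x ≤ m + Δ → x + y ≡ m + m → Δ ≤ m →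
             y * y ≤ (m + m) * (e + e) + Δ * x → m ≤ 4 * e + 4 * Δ
small-side {zero} _ _ _ _ _ = z≤n
small-side {m@(suc _)} {x} {y} {e} {Δ} m≤x x≤m+Δ x+y≡2m Δ≤m yy≤ = *-cancelˡ-≤ m (begin
  m * m                                     ≤⟨ *-mono-≤ m≤y+Δ m≤y+Δ ⟩
  (y + Δ) * (y + Δ)                         ≡⟨ solve 2 (λ y Δ → (y :+ Δ) :* (y :+ Δ)
                                                 := y :* y :+ Δ :* (y :+ y :+ Δ)) refl y Δ ⟩
  y * y + Δ * (y + y + Δ)                   ≤⟨ +-monoˡ-≤ _ yy≤ ⟩
  (m + m) * (e + e) + Δ * x + Δ * (y + y + Δ)
    ≡⟨ solve 5 (λ T e Δ x y → T :* e :+ Δ :* x :+ Δ :* (y :+ y :+ Δ)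
                  := T :* e :+ Δ :* (x :+ y :+ (y :+ Δ))) refl (m + m) (e + e) Δ x y ⟩
  (m + m) * (e + e) + Δ * (x + y + (y + Δ))
    ≤⟨ +-monoʳ-≤ ((m + m) * (e + e)) (*-monoʳ-≤ Δ (+-mono-≤ (≤-reflexive x+y≡2m) (+-mono-≤ y≤m Δ≤m))) ⟩
  (m + m) * (e + e) + Δ * (m + m + (m + m))
    ≡⟨ solve 3 (λ m e Δ → (m :+ m) :* (e :+ e) :+ Δ :* (m :+ m :+ (m :+ m))
                  := m :* (con 4 :* e :+ con 4 :* Δ)) refl m e Δ ⟩
  m * (4 * e + 4 * Δ)                       ∎)
  where
  open ≤-Reasoning
  y≤m : y ≤ m
  y≤m = +-cancelˡ-≤ m y m (begin
    m + y ≤⟨ +-monoˡ-≤ y m≤x ⟩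
    x + y ≡⟨ x+y≡2m ⟩
    m + m ∎)
  m≤y+Δ : m ≤ y + Δ
  m≤y+Δ = +-cancelˡ-≤ m m (y + Δ) (begin
    m + m       ≡⟨ x+y≡2m ⟨
    x + y       ≤⟨ +-monoˡ-≤ y x≤m+Δ ⟩
    m + Δ + y   ≡⟨ solve 3 (λ m Δ y → m :+ Δ :+ y := m :+ (y :+ Δ)) refl m Δ y ⟩
    m + (y + Δ) ∎)

module Halving {n} (H : Multigraph n) (loopless : Loopless H) (Δ : ℕ)
               (deg≤Δ : ∀ v → deg H v ≤ Δ) (2Δ≤m : Δ + Δ ≤ numEdges H) where

  m : ℕ
  m = numEdges H

  -- vol P · vol (∁ P) / 2m is the expected cut of a random set of the same volume.
  SmallCut : VertexSet n → Set
  SmallCut P = (m + m) * cut P H ≤ vol P H * vol (∁ P) H + Δ * vol P H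

  vol-∅ : vol ∅ H ≡ 0
  vol-∅ = ∑ˡ-zero (edges H)

  small-cut-∅ : SmallCut ∅
  small-cut-∅ = subst (_≤ vol ∅ H * vol (∁ ∅) H + Δ * vol ∅ H)
    (sym (trans (cong ((m + m) *_) (∑ˡ-zero (edges H))) (*-zeroʳ (m + m)))) z≤n

  add-vertex : ∀ {P} v → SmallCut P → vol P H < m → P v ≡ false → 0 < deg H v →
               deg H v * cut P H ≤ between P ｛ v ｝ H * vol (∁ P) H → SmallCut (P ∪ ｛ v ｝)
  add-vertex {P} v sc x<m Pv≡false 0<δ δc≤ay =
    subst (λ z → (m + m) * cut P′ H ≤ z * vol (∁ P′) H + Δ * z) (sym vol′≡x+δ)
      (small-cut-step {a = between P ｛ v ｝ H} (sym (vol+vol-∁ P H)) y≡δ+y′ 0<δ 2δ≤y (deg≤Δ v) cut′+2a≡c+δ δc≤ay sc)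
    where
    P′ = P ∪ ｛ v ｝
    δ = deg H v
    vol′≡x+δ : vol P′ H ≡ vol P H + δ
    vol′≡x+δ = vol-∪ P ｛ v ｝ H (disjoint-｛｝ Pv≡false)
    cut′+2a≡c+δ : cut P′ H + (between P ｛ v ｝ H + between P ｛ v ｝ H) ≡ cut P H + δ
    cut′+2a≡c+δ = trans (cut-∪ P ｛ v ｝ H (disjoint-｛｝ Pv≡false)) (cong (cut P H +_) (cut-｛｝ loopless v))
    y≡δ+y′ : vol (∁ P) H ≡ δ + vol (∁ P′) H
    y≡δ+y′ = +-cancelˡ-≡ (vol P H) _ _ (begin
      vol P H + vol (∁ P) H         ≡⟨ vol+vol-∁ P H ⟩
      m + m                         ≡⟨ vol+vol-∁ P′ H ⟨
      vol P′ H + vol (∁ P′) H       ≡⟨ cong (_+ vol (∁ P′) H) vol′≡x+δ ⟩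
      vol P H + δ + vol (∁ P′) H    ≡⟨ +-assoc (vol P H) δ _ ⟩
      vol P H + (δ + vol (∁ P′) H)  ∎)
      where open ≡-Reasoning
    2δ≤y : δ + δ ≤ vol (∁ P) H
    2δ≤y = ≤-trans (+-mono-≤ (deg≤Δ v) (deg≤Δ v)) (≤-trans 2Δ≤m (+-cancelˡ-≤ (vol P H) _ _ (begin
      vol P H + m           ≤⟨ +-monoˡ-≤ m (<⇒≤ x<m) ⟩
      m + m                 ≡⟨ vol+vol-∁ P H ⟨
      vol P H + vol (∁ P) H ∎)))
      where open ≤-Reasoning

  grow-step : ∀ P → SmallCut P → vol P H < m →
              ∃[ P′ ] SmallCut P′ × vol P H < vol P′ H × vol P′ H ≤ vol P H + Δ
  grow-step P sc x<m = extend (averaging A D A≤D 0<ΣD ΣDc≤ΣAy)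
    where
    A D : Fin n → ℕ
    A v = ⟦ ∁ P v ⟧ * between P ｛ v ｝ H
    D v = ⟦ ∁ P v ⟧ * deg H v
    A≤D : ∀ v → A v ≤ D v
    A≤D v = *-monoʳ-≤ ⟦ ∁ P v ⟧ (between≤vol P ｛ v ｝ H)
    m<y : m < vol (∁ P) H
    m<y = +-cancelˡ-< (vol P H) _ _ (subst (vol P H + m <_) (sym (vol+vol-∁ P H)) (+-monoˡ-< m x<m))
    0<ΣD : 0 < sum D
    0<ΣD = subst (0 <_) (sym (∑-deg≡vol (∁ P) H)) (≤-<-trans z≤n m<y)
    ΣDc≤ΣAy : sum D * cut P H ≤ sum A * vol (∁ P) H
    ΣDc≤ΣAy = subst₂ (λ d a → d * cut P H ≤ a * vol (∁ P) H)
      (sym (∑-deg≡vol (∁ P) H)) (sym (∑-between-｛｝≡between P (∁ P) H)) (≤-reflexive (*-comm (vol (∁ P) H) (cut P H)))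
    extend : ∃[ v ] 0 < D v × D v * cut P H ≤ A v * vol (∁ P) H →
             ∃[ P′ ] SmallCut P′ × vol P H < vol P′ H × vol P′ H ≤ vol P H + Δ
    extend (v , 0<Dv , Dvc≤Avy) =
      P ∪ ｛ v ｝ , add-vertex {P} v sc x<m Pv≡false 0<δ δc≤ay ,
      subst (vol P H <_) (sym vol′≡x+δ) (m<m+n (vol P H) 0<δ) ,
      ≤-trans (≤-reflexive vol′≡x+δ) (+-monoʳ-≤ (vol P H) (deg≤Δ v))
      where
      outside : ∀ b {k} → 0 < ⟦ not b ⟧ * k → b ≡ false
      outside false _ = refl
      Pv≡false : P v ≡ false
      Pv≡false = outside (P v) 0<Dv
      ⟦∁P⟧*≡ : ∀ k → ⟦ ∁ P v ⟧ * k ≡ k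
      ⟦∁P⟧*≡ k rewrite Pv≡false = *-identityˡ k
      0<δ : 0 < deg H v
      0<δ = subst (0 <_) (⟦∁P⟧*≡ _) 0<Dv
      δc≤ay : deg H v * cut P H ≤ between P ｛ v ｝ H * vol (∁ P) H
      δc≤ay = subst₂ (λ d a → d * cut P H ≤ a * vol (∁ P) H) (⟦∁P⟧*≡ _) (⟦∁P⟧*≡ _) Dvc≤Avy
      vol′≡x+δ : vol (P ∪ ｛ v ｝) H ≡ vol P H + deg H v
      vol′≡x+δ = vol-∪ P ｛ v ｝ H (disjoint-｛｝ Pv≡false)

  grow : ∀ fuel P → SmallCut P → vol P H ≤ m + Δ → m ≤ vol P H + fuel →
         ∃[ P ] SmallCut P × m ≤ vol P H × vol P H ≤ m + Δ
  grow zero P sc x≤m+Δ m≤x+0 = P , sc , subst (m ≤_) (+-identityʳ _) m≤x+0 , x≤m+Δ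
  grow (suc fuel) P sc x≤m+Δ m≤x+1+fuel with m ≤? vol P H
  ... | yes m≤x = P , sc , m≤x , x≤m+Δ
  ... | no m≰x = continue (grow-step P sc x<m)
    where
    x<m : vol P H < m
    x<m = ≰⇒> m≰x
    continue : ∃[ P′ ] SmallCut P′ × vol P H < vol P′ H × vol P′ H ≤ vol P H + Δ →
               ∃[ P ] SmallCut P × m ≤ vol P H × vol P H ≤ m + Δ
    continue (P′ , sc′ , x<x′ , x′≤x+Δ) =
      grow fuel P′ sc′ (≤-trans x′≤x+Δ (+-monoˡ-≤ Δ (<⇒≤ x<m)))
        (≤-trans m≤x+1+fuel (≤-trans (≤-reflexive (+-suc (vol P H) fuel)) (+-monoˡ-≤ fuel x<x′)))

  halving : ∃[ P ] m ≤ 4 * inner P H + 4 * Δ × m ≤ 4 * inner (∁ P) H + 4 * Δ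
  halving with P , sc , m≤x , x≤m+Δ ← grow m ∅ small-cut-∅ (subst (_≤ m + Δ) (sym vol-∅) z≤n)
                                                       (subst (λ x → m ≤ x + m) (sym vol-∅) ≤-refl)
    = P , inside-bound , outside-bound
    where
    x = vol P H
    y = vol (∁ P) H
    Δ≤m : Δ ≤ m
    Δ≤m = ≤-trans (m≤m+n Δ Δ) 2Δ≤m
    inside-bound : m ≤ 4 * inner P H + 4 * Δ
    inside-bound = large-side {m} {x} {inner P H} {Δ} m≤x
      (square≤ {m + m} {x} {y} {inner P H} {cut P H} {Δ * x} (vol+vol-∁ P H) (vol≡2inner+cut P H) sc)
    outside-bound : m ≤ 4 * inner (∁ P) H + 4 * Δ
    outside-bound = small-side {m} {x} {y} {inner (∁ P) H} {Δ} m≤x x≤m+Δ (vol+vol-∁ P H) Δ≤m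
      (square≤ {m + m} {y} {x} {inner (∁ P) H} {cut P H} {Δ * x}
        (trans (+-comm y x) (vol+vol-∁ P H))
        (trans (vol≡2inner+cut (∁ P) H) (cong (inner (∁ P) H + inner (∁ P) H +_) (cut-∁ P H)))
        (subst (λ z → (m + m) * cut P H ≤ z + Δ * x) (*-comm x y) sc))

≤16*+20*⇒≤180* : ∀ {M e Δ} → M ≤ 16 * e + 20 * Δ → 25 * Δ ≤ M → M ≤ 180 * e
≤16*+20*⇒≤180* {M} {e} {Δ} M≤ 25Δ≤M = ≤-trans (*-cancelˡ-≤ 5 5M≤5*80e) (*-monoˡ-≤ e (m≤m+n 80 100))
  where
  open ≤-Reasoning
  5M≤5*80e : 5 * M ≤ 5 * (80 * e)
  5M≤5*80e = +-cancelʳ-≤ (20 * M) _ _ (begin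
    5 * M + 20 * M               ≡⟨ solve 1 (λ M → con 5 :* M :+ con 20 :* M := con 25 :* M) refl M ⟩
    25 * M                       ≤⟨ *-monoʳ-≤ 25 M≤ ⟩
    25 * (16 * e + 20 * Δ)       ≡⟨ solve 2 (λ e Δ → con 25 :* (con 16 :* e :+ con 20 :* Δ)
                                      := con 5 :* (con 80 :* e) :+ con 20 :* (con 25 :* Δ)) refl e Δ ⟩
    5 * (80 * e) + 20 * (25 * Δ) ≤⟨ +-monoʳ-≤ (5 * (80 * e)) (*-monoʳ-≤ 20 25Δ≤M) ⟩
    5 * (80 * e) + 20 * M        ∎)

first-round-bound : ∀ {M e Δ} → M ≤ 4 * e + 4 * Δ → 25 * Δ ≤ M → M ≤ 180 * e
first-round-bound {M} {e} {Δ} M≤ =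
  ≤16*+20*⇒≤180* {M} {e} {Δ} (≤-trans M≤ (+-mono-≤ (*-monoˡ-≤ e (m≤m+n 4 12)) (*-monoˡ-≤ Δ (m≤m+n 4 16))))

second-round-bound : ∀ {M M₂ e Δ} → M ≤ 4 * M₂ + 4 * Δ → M₂ ≤ 4 * e + 4 * Δ → 25 * Δ ≤ M → M ≤ 180 * e
second-round-bound {M} {M₂} {e} {Δ} M≤ M₂≤ = ≤16*+20*⇒≤180* {M} {e} {Δ} (begin
  M                           ≤⟨ M≤ ⟩
  4 * M₂ + 4 * Δ              ≤⟨ +-monoˡ-≤ (4 * Δ) (*-monoʳ-≤ 4 M₂≤) ⟩
  4 * (4 * e + 4 * Δ) + 4 * Δ ≡⟨ solve 2 (λ e Δ → con 4 :* (con 4 :* e :+ con 4 :* Δ) :+ con 4 :* Δ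
                                     := con 16 :* e :+ con 20 :* Δ) refl e Δ ⟩
  16 * e + 20 * Δ             ∎)
  where open ≤-Reasoning

first-round-sparse : ∀ {M Δ} → 25 * Δ ≤ M → Δ + Δ ≤ M
first-round-sparse {M} {Δ} 25Δ≤M = ≤-trans (m≤m+n (Δ + Δ) (23 * Δ))
  (subst (_≤ M) (solve 1 (λ Δ → con 25 :* Δ := Δ :+ Δ :+ con 23 :* Δ) refl Δ) 25Δ≤M)

second-round-sparse : ∀ {M M₂ Δ} → M ≤ 4 * M₂ + 4 * Δ → 25 * Δ ≤ M → Δ + Δ ≤ M₂
second-round-sparse {M} {M₂} {Δ} M≤ 25Δ≤M = *-cancelˡ-≤ 4 (+-cancelʳ-≤ (4 * Δ) _ _ (begin
  4 * (Δ + Δ) + 4 * Δ ≡⟨ solve 1 (λ Δ → con 4 :* (Δ :+ Δ) :+ con 4 :* Δ := con 12 :* Δ) refl Δ ⟩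
  12 * Δ              ≤⟨ *-monoˡ-≤ Δ (m≤m+n 12 13) ⟩
  25 * Δ              ≤⟨ 25Δ≤M ⟩
  M                   ≤⟨ M≤ ⟩
  4 * M₂ + 4 * Δ      ∎))
  where open ≤-Reasoning

colour : Bool → Bool → Fin 3
colour true _ = zero
colour false true = suc zero
colour false false = suc (suc zero)

colour≟0 : ∀ a b → does (colour a b ≟ zero) ≡ a
colour≟0 true _ = refl
colour≟0 false true = refl
colour≟0 false false = refl

colour≟1 : ∀ a b → does (colour a b ≟ suc zero) ≡ not a ∧ b
colour≟1 true _ = refl
colour≟1 false true = refl
colour≟1 false false = refl

colour≟2 : ∀ a b → does (colour a b ≟ suc (suc zero)) ≡ not a ∧ not b
colour≟2 true _ = refl
colour≟2 false true = refl
colour≟2 false false = refl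

three-parts : ∀ {n} (H : Multigraph n) → Loopless H → ∀ Δ → (∀ v → deg H v ≤ Δ) → 25 * Δ ≤ numEdges H →
              ∃[ col ] ∀ c → numEdges H ≤ 180 * inner (λ v → does (col v ≟ c)) H
three-parts H loopless Δ deg≤Δ 25Δ≤M =
  first-round (Halving.halving H loopless Δ deg≤Δ (first-round-sparse {numEdges H} {Δ} 25Δ≤M))
  where
  M = numEdges H
  first-round : ∃[ P₁ ] M ≤ 4 * inner P₁ H + 4 * Δ × M ≤ 4 * inner (∁ P₁) H + 4 * Δ →
                ∃[ col ] ∀ c → M ≤ 180 * inner (λ v → does (col v ≟ c)) H
  first-round (P₁ , M≤P₁ , M≤∁P₁) = second-round (Halving.halving H₂ (loopless-[] loopless (∁ P₁)) Δ
    (λ v → ≤-trans (deg-[]≤deg H (∁ P₁) v) (deg≤Δ v)) (second-round-sparse {M} {M₂} {Δ} M≤4M₂+4Δ 25Δ≤M))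
    where
    H₂ = H [ ∁ P₁ ]
    M₂ = numEdges H₂
    M≤4M₂+4Δ : M ≤ 4 * M₂ + 4 * Δ
    M≤4M₂+4Δ = subst (λ k → M ≤ 4 * k + 4 * Δ) (sym (numEdges-[] H (∁ P₁))) M≤∁P₁
    second-round : ∃[ P₂ ] M₂ ≤ 4 * inner P₂ H₂ + 4 * Δ × M₂ ≤ 4 * inner (∁ P₂) H₂ + 4 * Δ →
                   ∃[ col ] ∀ c → M ≤ 180 * inner (λ v → does (col v ≟ c)) H
    second-round (P₂ , M₂≤P₂ , M₂≤∁P₂) = (λ v → colour (P₁ v) (P₂ v)) , bound
      where
      bound : ∀ c → M ≤ 180 * inner (λ v → does (colour (P₁ v) (P₂ v) ≟ c)) H
      bound zero = subst (λ k → M ≤ 180 * k) (sym (inner-cong H λ v → colour≟0 (P₁ v) (P₂ v)))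
        (first-round-bound {M} {inner P₁ H} {Δ} M≤P₁ 25Δ≤M)
      bound (suc zero) = subst (λ k → M ≤ 180 * k)
        (sym (trans (inner-cong H λ v → colour≟1 (P₁ v) (P₂ v)) (sym (inner-[] H (∁ P₁) P₂))))
        (second-round-bound {M} {M₂} {inner P₂ H₂} {Δ} M≤4M₂+4Δ M₂≤P₂ 25Δ≤M)
      bound (suc (suc zero)) = subst (λ k → M ≤ 180 * k)
        (sym (trans (inner-cong H λ v → colour≟2 (P₁ v) (P₂ v)) (sym (inner-[] H (∁ P₁) (∁ P₂)))))
        (second-round-bound {M} {M₂} {inner (∁ P₂) H₂} {Δ} M≤4M₂+4Δ M₂≤∁P₂ 25Δ≤M)

≤-foldr-⊔ : ∀ {xs : List ℕ} {x} → x ∈ xs → x ≤ foldr _⊔_ 0 xs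
≤-foldr-⊔ (here refl) = m≤m⊔n _ _
≤-foldr-⊔ {y ∷ _} (there x∈xs) = ≤-trans (≤-foldr-⊔ x∈xs) (m≤n⊔m y _)

deg≤maxDegree : ∀ {n} {H : Multigraph n} → Loopless H → ∀ v → deg H v ≤ maxDegree H
deg≤maxDegree {H = H} loopless v = begin
  deg H v         ≡⟨ cut-｛｝ loopless v ⟨
  cut ｛ v ｝ H    ≤⟨ cut-｛｝≤degree H v ⟩
  degree H v      ≤⟨ ≤-foldr-⊔ (∈-map⁺ (degree H) (∈-allFin v)) ⟩
  maxDegree H     ∎
  where open ≤-Reasoning

inducedEdges≡inner : ∀ {n} (H : Multigraph n) col c → inducedEdges H col c ≡ inner (λ v → does (col v ≟ c)) H
inducedEdges≡inner H col c = length-filter≡∑ˡ _ (edges H)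

lemma12 : ∀ {n} (H : Multigraph n) → Loopless H →
    25 * maxDegree H ≤ numEdges H →
    Σ (Fin n → Fin 3) (λ col → ∀ c → numEdges H ≤ 180 * inducedEdges H col c)
lemma12 H loopless 25Δ≤M =
  Product.map id (λ {col} bound c → subst (λ k → numEdges H ≤ 180 * k) (sym (inducedEdges≡inner H col c)) (bound c))
    (three-parts H loopless (maxDegree H) (deg≤maxDegree loopless) 25Δ≤M)
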